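{- For every integer $k \geq 1$, let $G_k$ be the graph with vertex set $\{v_1,v_2,\dots,v_{3k+1}\}$ and edge set \[ \{v_iv_{i+1} : 2 \le i \le 3k\} \cup \{v_1v_i : 2 \le i \le 3k+1\}. \] Then $G_k$ is a maximal outerplanar graph of order $n = 3k+1$ and $\gamma_{st}(G_k) = k+1 = \lceil (n+2)/3 \rceil$; in particular $\{v_1\}\cup\{v_{3i} : 1 \le i \le k\}$ is a minimum secure total dominating set of $G_k$.
   Context: All graphs are finite, simple and undirected. A graph is outerplanar if it has a crossing-free embedding in the plane such that all vertices lie on the boundary of the outer face; it is maximal outerplanar if it is outerplanar and adding any single new edge yields a graph that is not outerplanar. A set $S \subseteq V(G)$ is a total dominating set if every vertex of $G$ is adjacent to some vertex of $S$. A total dominating set $S$ is a secure total dominating set if for every $u \in V(G)\setminus S$ there exists $v \in S$ with $uv \in E(G)$ such that $(S\setminus\{v\})\cup\{u\}$ is also a total dominating set. $\gamma_{st}(G)$ is the minimum cardinality of a secure total dominating set of $G$. -}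

module Defs where

open import Data.Nat using (ℕ; zero; suc; _+_; _*_; _≤_; _<_)
open import Data.Nat.DivMod using (_%_)
open import Data.Nat.Properties using (_≟_)
open import Data.Bool using (Bool; true; false; _∨_)
open import Data.Fin using (Fin; toℕ)
open import Data.Fin.Subset using (Subset; _∈_; _∉_; inside; outside)
open import Data.Fin.Permutation using (Permutation′; _⟨$⟩ʳ_)
open import Data.Vec using (_[_]≔_; tabulate)
open import Data.Product using (Σ; ∃; _×_; _,_)
open import Data.Sum using (_⊎_)
open import Relation.Nullary using (¬_; ⌊_⌋)
open import Relation.Binary.PropositionalEquality using (_≡_; _≢_)

Graph : ℕ → Set₁
Graph n = Fin n → Fin n → Set

IsSimple : {n : ℕ} → Graph n → Set
IsSimple {n} E = (∀ x y → E x y → E y x) × (∀ x → ¬ E x x)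

-- Chords between circle positions a–b and c–d cross iff a < c < b < d.
Crossing : {n : ℕ} → Fin n → Fin n → Fin n → Fin n → Set
Crossing a b c d = toℕ a < toℕ c × toℕ c < toℕ b × toℕ b < toℕ d

-- Outerplanar: the vertices can be placed (in the cyclic order given by a
-- permutation σ) on the boundary of the outer face, i.e. on a circle, with
-- all edges drawn as non-crossing chords.
Outerplanar : {n : ℕ} → Graph n → Set
Outerplanar {n} E = Σ (Permutation′ n) λ σ →
  ∀ a b c d → E a b → E c d → ¬ Crossing (σ ⟨$⟩ʳ a) (σ ⟨$⟩ʳ b) (σ ⟨$⟩ʳ c) (σ ⟨$⟩ʳ d)

AddEdge : {n : ℕ} → Graph n → Fin n → Fin n → Graph n
AddEdge E u v x y = E x y ⊎ ((x ≡ u × y ≡ v) ⊎ (x ≡ v × y ≡ u))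

MaximalOuterplanar : {n : ℕ} → Graph n → Set
MaximalOuterplanar {n} E =
  Outerplanar E ×
  (∀ u v → u ≢ v → ¬ E u v → ¬ Outerplanar (AddEdge E u v))

TotalDominating : {n : ℕ} → Graph n → Subset n → Set
TotalDominating {n} E S = ∀ x → ∃ λ y → y ∈ S × E x y

swap : {n : ℕ} → Subset n → Fin n → Fin n → Subset n
swap S v u = (S [ v ]≔ outside) [ u ]≔ inside

SecureTotalDominating : {n : ℕ} → Graph n → Subset n → Set
SecureTotalDominating {n} E S =
  TotalDominating E S ×
  (∀ u → u ∉ S → ∃ λ v → v ∈ S × E u v × TotalDominating E (swap S v u))

MinimumSTD : {n : ℕ} → Graph n → Subset n → Set
MinimumSTD {n} E S =
  SecureTotalDominating E S × (∀ T → SecureTotalDominating E T → Data.Fin.Subset.∣ S ∣ ≤ Data.Fin.Subset.∣ T ∣)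

GammaST : {n : ℕ} → Graph n → ℕ → Set
GammaST {n} E m =
  (∃ λ S → SecureTotalDominating E S × Data.Fin.Subset.∣ S ∣ ≡ m) ×
  (∀ T → SecureTotalDominating E T → m ≤ Data.Fin.Subset.∣ T ∣)

-- The graph G_k on Fin (3k+1); vertex v_i is the element with toℕ = i - 1.
-- Edges v_i v_{i+1} (2 ≤ i ≤ 3k) become a–(a+1) with a ≥ 1;
-- edges v_1 v_i (2 ≤ i ≤ 3k+1) become 0–b with b ≥ 1.
FanEdge : ℕ → ℕ → Set
FanEdge a b = (1 ≤ a × b ≡ suc a) ⊎ (a ≡ 0 × 1 ≤ b)

G : (k : ℕ) → Graph (3 * k + 1)
G k x y = FanEdge (toℕ x) (toℕ y) ⊎ FanEdge (toℕ y) (toℕ x)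

-- {v_1} ∪ {v_{3i} : 1 ≤ i ≤ k}: indices 0 and those ≡ 2 (mod 3).
Sk : (k : ℕ) → Subset (3 * k + 1)
Sk k = tabulate λ x → ⌊ toℕ x ≟ 0 ⌋ ∨ ⌊ toℕ x % 3 ≟ 2 ⌋

module Submission where

-- Vertices are numbered as in Defs: 0 is the centre v₁, and 1, …, 3k form the spine path.
--
-- For non-adjacent spine vertices u < v, the new edge uv and the spine from u + 1
-- to v turn the centre, u, u + 1 and v into a K₄ with one edge subdivided. Place the vertices
-- on a line as in an outerplanar drawing. Then a chord ab never separates the ends of an edge,
-- or of a walk, that avoids a and b. So none of the three ways of pairing up these four
-- vertices would be separating, whereas for any four points on a line an odd number are.
--
-- If a total dominating set avoids the centre, every spine vertex has a dominator
-- on the spine. This puts two vertices into {1, 2, 3} and one into each later block of three,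
-- so the set has at least k + 1 vertices. Now take a secure total dominating set T that
-- contains the centre. If every block {3j + 1, 3j + 2, 3j + 3} meets T, then again
-- |T| ≥ k + 1. Otherwise, the middle vertex of a missed block can only be defended by the
-- centre, and exchanging the two gives a total dominating set of the same size that avoids
-- the centre. Conversely, any set containing the centre and another vertex is total
-- dominating, and each vertex outside Sk k has a spine neighbour in Sk k, so Sk k is secure.

open import Defs
open import Data.Nat using (ℕ; zero; suc; _+_; _*_; _≤_; _<_; _<?_; _≤?_; _∸_; z≤n; s≤s; s≤s⁻¹)
open import Data.Nat.Properties
  using (<-asym; <-irrefl; <-trans; <-cmp; <⇒≤; <⇒≱; ≤-antisym; ≤-trans; ≤-<-trans; ≮⇒≥;
         ≤∧≢⇒<; m<n⇒m<1+n; n<1+n; n≤1+n; m≤m+n; m≤n+m; 1+n≢n; n≢0⇒n>0;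
         +-mono-≤; +-monoʳ-≤; *-monoˡ-≤; +-assoc; +-comm; *-comm; +-identityʳ; *-identityʳ;
         +-suc; m+[n∸m]≡n)
  renaming (_≟_ to _≟ℕ_)
open import Data.Bool using (Bool; true; false; _∨_; _xor_; if_then_else_)
open import Data.Bool.Properties using (xor-same; ∨-zeroʳ)
open import Data.Nat.DivMod using (_/_; _%_; [m+n]%n≡m%n; [m+kn]%n≡m%n; +-distrib-/-∣ʳ; m*n/n≡m)
open import Data.Nat.Divisibility using (divides-refl)
open import Data.Nat.Tactic.RingSolver using (solve-∀)
open import Data.Bool.Solver using (module xor-∧-Solver)
open import Data.Fin using (Fin; zero; suc; toℕ; fromℕ<)
open import Data.Fin.Properties using (toℕ-injective; toℕ-fromℕ<; toℕ<n; all?; ¬∀⟶∃¬)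
open import Data.Fin.Permutation using (Permutation′; _⟨$⟩ʳ_; _⟨$⟩ˡ_; inverseˡ)
import Data.Fin.Permutation as Permutation
open import Data.Product using (_×_; _,_; ∃; proj₁; proj₂; uncurry)
open import Data.Fin.Subset using (Subset; _∈_; _∉_; inside; outside; ∣_∣)
open import Data.Vec using (_∷_; []; lookup; _[_]≔_)
open import Data.Vec.Properties
  using ([]=⇒lookup; lookup⇒[]=; lookup∘update; lookup∘update′; []≔-updates; []≔-minimal;
         lookup∘tabulate)
open import Data.Sum using (_⊎_; inj₁; inj₂; [_,_]; [_,_]′)
import Data.Sum as Sum
open import Data.Empty using (⊥; ⊥-elim)
open import Function using (_∘_; id; case_of_)
open import Relation.Nullary using (¬_; yes; no; ⌊_⌋)
open import Relation.Binary.Definitions using (tri<; tri≈; tri>)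
open import Relation.Binary.PropositionalEquality
  using (_≡_; _≢_; refl; sym; trans; cong; cong₂; subst; module ≡-Reasoning)
open Data.Nat.Properties using (module ≤-Reasoning)
open import Relation.Binary.Construct.Closure.ReflexiveTransitive using (Star; ε; _◅_; fold; map)

true≢false : true ≢ false
true≢false ()

-- For x ∉ {a, b}: x lies strictly between a and b iff exactly one of a, b is below x.
between : ℕ → ℕ → ℕ → Bool
between a b x = ⌊ a <? x ⌋ xor ⌊ b <? x ⌋

separates : ℕ → ℕ → ℕ → ℕ → Bool
separates a b c d = between a b c xor between a b d

≢⇒exactly-one-< : ∀ {x y} → x ≢ y → ⌊ x <? y ⌋ xor ⌊ y <? x ⌋ ≡ true
≢⇒exactly-one-< {x} {y} x≢y with x <? y | y <? x
... | yes x<y | yes y<x = ⊥-elim (<-asym x<y y<x)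
... | yes _   | no  _   = refl
... | no  _   | yes _   = refl
... | no  x≮y | no  y≮x = ⊥-elim (x≢y (≤-antisym (≮⇒≥ y≮x) (≮⇒≥ x≮y)))

-- In the sum of the three pairings of a, b, c, d every comparison with a occurs twice,
-- and the comparisons among b, c, d occur once in each direction.
separates-parity : ∀ a {b c d} → b ≢ c → b ≢ d → c ≢ d →
  separates a b c d xor (separates a c b d xor separates a d b c) ≡ true
separates-parity a {b} {c} {d} b≢c b≢d c≢d = begin
  separates a b c d xor (separates a c b d xor separates a d b c)
    ≡⟨ solve 9 (λ ab ac ad bc cb bd db cd dc →
         ((ac :+ bc) :+ (ad :+ bd)) :+ (((ab :+ cb) :+ (ad :+ cd)) :+ ((ab :+ db) :+ (ac :+ dc)))
         := (bc :+ cb) :+ ((bd :+ db) :+ (cd :+ dc)))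
       refl (lt a b) (lt a c) (lt a d) (lt b c) (lt c b) (lt b d) (lt d b) (lt c d) (lt d c) ⟩
  (lt b c xor lt c b) xor ((lt b d xor lt d b) xor (lt c d xor lt d c))
    ≡⟨ cong₂ _xor_ (≢⇒exactly-one-< b≢c)
                   (cong₂ _xor_ (≢⇒exactly-one-< b≢d) (≢⇒exactly-one-< c≢d)) ⟩
  true ∎
  where
  open ≡-Reasoning
  open xor-∧-Solver
  lt : ℕ → ℕ → Bool
  lt x y = ⌊ x <? y ⌋

≮∧≢⇒> : ∀ {m n} → ¬ m < n → n ≢ m → n < m
≮∧≢⇒> m≮n n≢m = ≤∧≢⇒< (≮⇒≥ m≮n) n≢m

Restrict : ∀ {n} → Graph n → (Fin n → Set) → Graph n
Restrict E P x y = E x y × P x × P y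

module Drawing {n} {E : Graph n} (E-sym : ∀ x y → E x y → E y x) (drawing : Outerplanar E) where

  pos : Fin n → ℕ
  pos x = toℕ (proj₁ drawing ⟨$⟩ʳ x)

  pos-injective : ∀ {x y} → pos x ≡ pos y → x ≡ y
  pos-injective eq =
    trans (sym (inverseˡ σ)) (trans (cong (σ ⟨$⟩ˡ_) (toℕ-injective eq)) (inverseˡ σ))
    where
    σ : Permutation′ n
    σ = proj₁ drawing

  private
    below : ∀ {x y} → x ≢ y → ¬ pos y < pos x → pos x < pos y
    below x≢y y≮x = ≮∧≢⇒> y≮x (x≢y ∘ pos-injective)

  edge-cannot-cross : ∀ {a b x y} → E a b → E x y → pos a < pos x → pos x < pos b →
    pos y < pos a ⊎ pos b < pos y → ⊥
  edge-cannot-cross {a} {b} {x} {y} ab xy a<x x<b (inj₁ y<a) =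
    proj₂ drawing y x a b (E-sym x y xy) ab (y<a , a<x , x<b)
  edge-cannot-cross {a} {b} {x} {y} ab xy a<x x<b (inj₂ b<y) =
    proj₂ drawing a b x y ab xy (a<x , x<b , b<y)

  edge-stays-on-side : ∀ {a b c d} → E a b → E c d → c ≢ a → c ≢ b → d ≢ a → d ≢ b →
    between (pos a) (pos b) (pos c) ≡ between (pos a) (pos b) (pos d)
  edge-stays-on-side {a} {b} {c} {d} ab cd c≢a c≢b d≢a d≢b
    with pos a <? pos c | pos b <? pos c | pos a <? pos d | pos b <? pos d
  ... | yes _   | yes _   | yes _   | yes _   = refl
  ... | yes _   | yes b<c | yes a<d | no  b≮d =
    ⊥-elim (edge-cannot-cross ab (E-sym c d cd) a<d (below d≢b b≮d) (inj₂ b<c))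
  ... | yes a<c | yes _   | no  a≮d | yes b<d =
    ⊥-elim (edge-cannot-cross (E-sym a b ab) (E-sym c d cd) b<d (below d≢a a≮d) (inj₂ a<c))
  ... | yes _   | yes _   | no  _   | no  _   = refl
  ... | yes a<c | no  b≮c | yes _   | yes b<d =
    ⊥-elim (edge-cannot-cross ab cd a<c (below c≢b b≮c) (inj₂ b<d))
  ... | yes _   | no  _   | yes _   | no  _   = refl
  ... | yes _   | no  _   | no  _   | yes _   = refl
  ... | yes a<c | no  b≮c | no  a≮d | no  _   =
    ⊥-elim (edge-cannot-cross ab cd a<c (below c≢b b≮c) (inj₁ (below d≢a a≮d)))
  ... | no  a≮c | yes b<c | yes a<d | yes _   =
    ⊥-elim (edge-cannot-cross (E-sym a b ab) cd b<c (below c≢a a≮c) (inj₂ a<d))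
  ... | no  _   | yes _   | yes _   | no  _   = refl
  ... | no  _   | yes _   | no  _   | yes _   = refl
  ... | no  a≮c | yes b<c | no  _   | no  b≮d =
    ⊥-elim (edge-cannot-cross (E-sym a b ab) cd b<c (below c≢a a≮c) (inj₁ (below d≢b b≮d)))
  ... | no  _   | no  _   | yes _   | yes _   = refl
  ... | no  a≮c | no  _   | yes a<d | no  b≮d =
    ⊥-elim (edge-cannot-cross ab (E-sym c d cd) a<d (below d≢b b≮d) (inj₁ (below c≢a a≮c)))
  ... | no  _   | no  b≮c | no  a≮d | yes b<d =
    ⊥-elim (edge-cannot-cross (E-sym a b ab) (E-sym c d cd) b<d (below d≢a a≮d)
                              (inj₁ (below c≢b b≮c)))
  ... | no  _   | no  _   | no  _   | no  _   = refl

  Avoiding : Fin n → Fin n → Graph n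
  Avoiding a b = Restrict E (λ z → z ≢ a × z ≢ b)

  walk-stays-on-side : ∀ {a b c d} → E a b → Star (Avoiding a b) c d →
    between (pos a) (pos b) (pos c) ≡ between (pos a) (pos b) (pos d)
  walk-stays-on-side {a} {b} ab = fold (λ x y → side x ≡ side y) step refl
    where
    side : Fin n → Bool
    side x = between (pos a) (pos b) (pos x)
    step : ∀ {x y z} → Avoiding a b x y → side y ≡ side z → side x ≡ side z
    step (xy , (x≢a , x≢b) , (y≢a , y≢b)) = trans (edge-stays-on-side ab xy x≢a x≢b y≢a y≢b)

  no-subdivided-K₄ : ∀ {a b c d} → b ≢ a → c ≢ a → d ≢ a → c ≢ b → d ≢ b → d ≢ c →
    E a b → E a c → E a d → E b c → E b d → Star (Avoiding a b) c d → ⊥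
  no-subdivided-K₄ {a} {b} {c} {d} b≢a c≢a d≢a c≢b d≢b d≢c ab ac ad bc bd c⇝d
    = true≢false (trans
        (sym (separates-parity (pos a) (≢pos (c≢b ∘ sym)) (≢pos (d≢b ∘ sym)) (≢pos (d≢c ∘ sym))))
        (cong₂ _xor_ ab∣cd (cong₂ _xor_ ac∣bd ad∣bc)))
    where
    ≢pos : ∀ {x y} → x ≢ y → pos x ≢ pos y
    ≢pos x≢y = x≢y ∘ pos-injective
    same-side : ∀ {x y} → x ≡ y → x xor y ≡ false
    same-side {y = y} refl = xor-same y
    ab∣cd : separates (pos a) (pos b) (pos c) (pos d) ≡ false
    ab∣cd = same-side (walk-stays-on-side ab c⇝d)
    ac∣bd : separates (pos a) (pos c) (pos b) (pos d) ≡ false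
    ac∣bd = same-side (edge-stays-on-side ac bd b≢a (c≢b ∘ sym) d≢a d≢c)
    ad∣bc : separates (pos a) (pos d) (pos b) (pos c) ≡ false
    ad∣bc = same-side (edge-stays-on-side ad bc b≢a (d≢b ∘ sym) c≢a (d≢c ∘ sym))

outerplanar-⊆ : ∀ {n} {E F : Graph n} → (∀ {x y} → E x y → F x y) → Outerplanar F → Outerplanar E
outerplanar-⊆ E⊆F (σ , uncrossed) = σ , λ a b c d ab cd → uncrossed a b c d (E⊆F ab) (E⊆F cd)

AddEdge-sym : ∀ {n} {E : Graph n} {u v} → (∀ x y → E x y → E y x) →
  ∀ x y → AddEdge E u v x y → AddEdge E u v y x
AddEdge-sym E-sym x y (inj₁ xy)                  = inj₁ (E-sym x y xy)
AddEdge-sym E-sym x y (inj₂ (inj₁ (x≡u , y≡v))) = inj₂ (inj₂ (y≡v , x≡u))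
AddEdge-sym E-sym x y (inj₂ (inj₂ (x≡v , y≡u))) = inj₂ (inj₁ (y≡u , x≡v))

AddEdge-comm : ∀ {n} {E : Graph n} {u v x y} → AddEdge E u v x y → AddEdge E v u x y
AddEdge-comm = Sum.map₂ Sum.swap

-- G k is Fan (3 * k + 1) by definition, so the lemmas on Fan n apply to it directly.
FanAdjacent : ℕ → ℕ → Set
FanAdjacent a b = FanEdge a b ⊎ FanEdge b a

Fan : (n : ℕ) → Graph n
Fan n x y = FanAdjacent (toℕ x) (toℕ y)

Fan-sym : ∀ {n} (x y : Fin n) → Fan n x y → Fan n y x
Fan-sym x y = Sum.swap

FanEdge-irreflexive : ∀ a → ¬ FanEdge a a
FanEdge-irreflexive a (inj₁ (_ , a≡1+a)) = 1+n≢n (sym a≡1+a)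
FanEdge-irreflexive a (inj₂ (refl , ()))

Fan-simple : ∀ n → IsSimple (Fan n)
Fan-simple n = Fan-sym , λ x → [ FanEdge-irreflexive (toℕ x) , FanEdge-irreflexive (toℕ x) ]

FanAdjacent-uncrossed : ∀ {a b c d} → FanAdjacent a b → FanAdjacent c d → ¬ (a < c × c < b × b < d)
FanAdjacent-uncrossed (inj₁ (inj₁ (_ , refl))) _ (a<c , c<1+a , _) = <⇒≱ a<c (s≤s⁻¹ c<1+a)
FanAdjacent-uncrossed (inj₂ (inj₁ (_ , refl))) _ (1+b<c , c<b , _) = <-asym (<-trans 1+b<c c<b) (n<1+n _)
FanAdjacent-uncrossed (inj₂ (inj₂ (refl , _))) _ (_ , () , _)
FanAdjacent-uncrossed (inj₁ (inj₂ (refl , _))) (inj₁ (inj₁ (_ , refl))) (_ , c<b , b<1+c) =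
  <⇒≱ c<b (s≤s⁻¹ b<1+c)
FanAdjacent-uncrossed (inj₁ (inj₂ (refl , _))) (inj₁ (inj₂ (refl , _))) (() , _)
FanAdjacent-uncrossed (inj₁ (inj₂ (refl , _))) (inj₂ (inj₁ (_ , refl))) (_ , 1+d<b , b<d) =
  <-asym (<-trans (n<1+n _) 1+d<b) b<d
FanAdjacent-uncrossed (inj₁ (inj₂ (refl , _))) (inj₂ (inj₂ (refl , _))) (_ , _ , ())

Fan-outerplanar : ∀ n → Outerplanar (Fan n)
Fan-outerplanar n = Permutation.id , λ a b c d → FanAdjacent-uncrossed

spine-walk : ∀ {n i} {x y : Fin n} → i < toℕ x → toℕ x ≤ toℕ y →
  Star (Restrict (Fan n) (λ z → i < toℕ z)) x y
spine-walk {n} {i} {x} {y} i<x x≤y = walk (toℕ y ∸ toℕ x) x i<x (m+[n∸m]≡n x≤y)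
  where
  walk : ∀ m z → i < toℕ z → toℕ z + m ≡ toℕ y → Star (Restrict (Fan n) (λ z → i < toℕ z)) z y
  walk zero z i<z z+0≡y = subst (Star _ z) (toℕ-injective (trans (sym (+-identityʳ (toℕ z))) z+0≡y)) ε
  walk (suc m) z i<z z+1+m≡y =
    (spine , i<z , i<z′) ◅ walk m z′ i<z′ (trans (cong (_+ m) z′≡1+z) z′+m≡y)
    where
    z′+m≡y : suc (toℕ z) + m ≡ toℕ y
    z′+m≡y = trans (sym (+-suc (toℕ z) m)) z+1+m≡y
    z′ : Fin n
    z′ = fromℕ< (≤-<-trans (m≤m+n (suc (toℕ z)) m) (subst (_< n) (sym z′+m≡y) (toℕ<n y)))
    z′≡1+z : toℕ z′ ≡ suc (toℕ z)
    z′≡1+z = toℕ-fromℕ< _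
    i<z′ : i < toℕ z′
    i<z′ = subst (i <_) (sym z′≡1+z) (m<n⇒m<1+n i<z)
    spine : Fan n z z′
    spine = inj₁ (inj₁ (≤-trans (s≤s z≤n) i<z , z′≡1+z))

Fan+chord-not-outerplanar : ∀ {n} {u v : Fin n} → 1 ≤ toℕ u → 2 + toℕ u ≤ toℕ v →
  ¬ Outerplanar (AddEdge (Fan n) u v)
Fan+chord-not-outerplanar {n} {u} {v} 1≤u 2+u≤v drawing =
  no-subdivided-K₄ u≢o (proj₁ (above u<w)) (proj₁ (above u<v))
                       (proj₂ (above u<w)) (proj₂ (above u<v)) v≢w
    (spoke 1≤u) (spoke (≤-trans (s≤s z≤n) u<w)) (spoke (≤-trans (s≤s z≤n) u<v))
    (inj₁ (inj₁ (inj₁ (1≤u , toℕ-fromℕ< _)))) (inj₂ (inj₁ (refl , refl)))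
    (map (λ (xy , u<x , u<y) → inj₁ xy , above u<x , above u<y) (spine-walk u<w (<⇒≤ w<v)))
  where
  open Drawing (AddEdge-sym Fan-sym) drawing
  u<v : toℕ u < toℕ v
  u<v = <-trans (n<1+n _) 2+u≤v
  o w : Fin n
  o = fromℕ< (≤-<-trans z≤n (toℕ<n u))
  w = fromℕ< (<-trans 2+u≤v (toℕ<n v))
  o≡0 : toℕ o ≡ 0
  o≡0 = toℕ-fromℕ< _
  u<w : toℕ u < toℕ w
  u<w = subst (toℕ u <_) (sym (toℕ-fromℕ< _)) (n<1+n _)
  w<v : toℕ w < toℕ v
  w<v = subst (_< toℕ v) (sym (toℕ-fromℕ< _)) 2+u≤v
  apart : ∀ {x y : Fin n} → toℕ y < toℕ x → x ≢ y
  apart y<x x≡y = <-irrefl (cong toℕ (sym x≡y)) y<x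
  above : ∀ {z} → toℕ u < toℕ z → z ≢ o × z ≢ u
  above {z} u<z = apart (subst (_< toℕ z) (sym o≡0) (≤-<-trans z≤n u<z)) , apart u<z
  u≢o : u ≢ o
  u≢o = apart (subst (_< toℕ u) (sym o≡0) 1≤u)
  v≢w : v ≢ w
  v≢w = apart w<v
  spoke : ∀ {z} → 1 ≤ toℕ z → AddEdge (Fan n) u v o z
  spoke 1≤z = inj₁ (inj₁ (inj₂ (o≡0 , 1≤z)))

Fan-non-adjacent : ∀ {n} {u v : Fin n} → toℕ u < toℕ v → ¬ Fan n u v → 1 ≤ toℕ u × 2 + toℕ u ≤ toℕ v
Fan-non-adjacent {u = u} {v} u<v ¬uv with toℕ u ≟ℕ 0 | toℕ v ≟ℕ suc (toℕ u)
... | yes u≡0 | _         = ⊥-elim (¬uv (inj₁ (inj₂ (u≡0 , ≤-trans (s≤s z≤n) u<v))))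
... | no  u≢0 | yes v≡1+u = ⊥-elim (¬uv (inj₁ (inj₁ (n≢0⇒n>0 u≢0 , v≡1+u))))
... | no  u≢0 | no  v≢1+u = n≢0⇒n>0 u≢0 , ≤∧≢⇒< u<v (v≢1+u ∘ sym)

Fan-maximal-outerplanar : ∀ n → MaximalOuterplanar (Fan n)
Fan-maximal-outerplanar n = Fan-outerplanar n , chord
  where
  chord : ∀ u v → u ≢ v → ¬ Fan n u v → ¬ Outerplanar (AddEdge (Fan n) u v)
  chord u v u≢v ¬uv with <-cmp (toℕ u) (toℕ v)
  ... | tri< u<v _ _ = uncurry Fan+chord-not-outerplanar (Fan-non-adjacent u<v ¬uv)
  ... | tri≈ _ u≡v _ = ⊥-elim (u≢v (toℕ-injective u≡v))
  ... | tri> _ _ v<u = uncurry Fan+chord-not-outerplanar (Fan-non-adjacent v<u (¬uv ∘ Fan-sym v u))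
                     ∘ outerplanar-⊆ (AddEdge-comm {E = Fan n})

bit : Bool → ℕ
bit b = if b then 1 else 0

count : (ℕ → Bool) → ℕ → ℕ → ℕ
count f a zero    = 0
count f a (suc m) = bit (f a) + count f (suc a) m

count-suc : ∀ f a m → count f (suc a) m ≡ count (f ∘ suc) a m
count-suc f a zero    = refl
count-suc f a (suc m) = cong (bit (f (suc a)) +_) (count-suc f (suc a) m)

count-+ : ∀ f a m m′ → count f a (m + m′) ≡ count f a m + count f (a + m) m′
count-+ f a zero    m′ = cong (λ b → count f b m′) (sym (+-identityʳ a))
count-+ f a (suc m) m′ = begin
  bit (f a) + count f (suc a) (m + m′)
    ≡⟨ cong (bit (f a) +_) (count-+ f (suc a) m m′) ⟩
  bit (f a) + (count f (suc a) m + count f (suc a + m) m′)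
    ≡⟨ +-assoc (bit (f a)) _ _ ⟨
  bit (f a) + count f (suc a) m + count f (suc a + m) m′
    ≡⟨ cong (λ b → bit (f a) + count f (suc a) m + count f b m′) (+-suc a m) ⟨
  bit (f a) + count f (suc a) m + count f (a + suc m) m′   ∎
  where open ≡-Reasoning

count-hit : ∀ f a {j m} → j < m → f (j + a) ≡ true → 1 ≤ count f a m
count-hit f a {zero}  {suc m} _   fa≡true rewrite fa≡true = s≤s z≤n
count-hit f a {suc j} {suc m} j<m f≡true = ≤-trans
  (count-hit f (suc a) (s≤s⁻¹ j<m) (subst (λ i → f i ≡ true) (sym (+-suc j a)) f≡true))
  (m≤n+m _ (bit (f a)))

two-of-three : ∀ f {a} → f (suc a) ≡ true → f a ≡ true ⊎ f (2 + a) ≡ true → 2 ≤ count f a 3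
two-of-three f {a} middle (inj₁ left)  rewrite middle | left  = s≤s (s≤s z≤n)
two-of-three f {a} middle (inj₂ right) rewrite middle | right = m≤n+m 2 (bit (f a))

count-blocks : ∀ f a w m → (∀ (j : Fin m) → 1 ≤ count f (a + toℕ j * w) w) → m ≤ count f a (m * w)
count-blocks f a w zero    hit = z≤n
count-blocks f a w (suc m) hit = begin
  suc m                                 ≤⟨ +-mono-≤ first rest ⟩
  count f a w + count f (a + w) (m * w) ≡⟨ count-+ f a w (m * w) ⟨
  count f a (w + m * w)                 ∎
  where
  open ≤-Reasoning
  first : 1 ≤ count f a w
  first = subst (λ b → 1 ≤ count f b w) (+-identityʳ a) (hit zero)
  rest : m ≤ count f (a + w) (m * w)
  rest = count-blocks f (a + w) w m λ j →
    subst (λ b → 1 ≤ count f b w) (sym (+-assoc a w _)) (hit (suc j))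

count-shift-period : ∀ f w → (∀ i → f (i + w) ≡ f i) → ∀ a m → count f (a + w) m ≡ count f a m
count-shift-period f w period a zero    = refl
count-shift-period f w period a (suc m) =
  cong₂ _+_ (cong bit (period a)) (count-shift-period f w period (suc a) m)

count-periodic : ∀ f w → (∀ i → f (i + w) ≡ f i) → ∀ a m → count f a (m * w) ≡ m * count f a w
count-periodic f w period a zero    = refl
count-periodic f w period a (suc m) = begin
  count f a (w + m * w)                 ≡⟨ count-+ f a w (m * w) ⟩
  count f a w + count f (a + w) (m * w)
    ≡⟨ cong (count f a w +_) (count-shift-period f w period a (m * w)) ⟩
  count f a w + count f a (m * w)       ≡⟨ cong (count f a w +_) (count-periodic f w period a m) ⟩
  count f a w + m * count f a w         ∎
  where open ≡-Reasoning

-- Membership by index; indices beyond n are reported as non-members.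
mem : ∀ {n} → Subset n → ℕ → Bool
mem []      _       = false
mem (b ∷ p) zero    = b
mem (b ∷ p) (suc i) = mem p i

mem-toℕ : ∀ {n} (p : Subset n) x → mem p (toℕ x) ≡ lookup p x
mem-toℕ (b ∷ p) zero    = refl
mem-toℕ (b ∷ p) (suc x) = mem-toℕ p x

∈⇒mem : ∀ {n} {p : Subset n} {x} → x ∈ p → mem p (toℕ x) ≡ true
∈⇒mem {p = p} {x} x∈p = trans (mem-toℕ p x) ([]=⇒lookup x∈p)

∉⇒lookup≡false : ∀ {n} {p : Subset n} {x} → x ∉ p → lookup p x ≡ false
∉⇒lookup≡false {p = p} {x} x∉p with lookup p x in eq
... | true  = ⊥-elim (x∉p (lookup⇒[]= x p eq))
... | false = refl

∣p∣≡count : ∀ {n} (p : Subset n) f → (∀ x → lookup p x ≡ f (toℕ x)) → ∣ p ∣ ≡ count f 0 n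
∣p∣≡count []      f _  = refl
∣p∣≡count {suc n} (b ∷ p) f eq = begin
  ∣ b ∷ p ∣                            ≡⟨ ∣b∷p∣ b ⟩
  bit b + ∣ p ∣
    ≡⟨ cong₂ _+_ (cong bit (eq zero)) (∣p∣≡count p (f ∘ suc) (eq ∘ suc)) ⟩
  bit (f 0) + count (f ∘ suc) 0 n      ≡⟨ cong (bit (f 0) +_) (count-suc f 0 n) ⟨
  count f 0 (suc n)                    ∎
  where
  open ≡-Reasoning
  ∣b∷p∣ : ∀ b → ∣ b ∷ p ∣ ≡ bit b + ∣ p ∣
  ∣b∷p∣ true  = refl
  ∣b∷p∣ false = refl

∣p∣≡count-mem : ∀ {n} (p : Subset n) → ∣ p ∣ ≡ count (mem p) 0 n
∣p∣≡count-mem p = ∣p∣≡count p (mem p) (sym ∘ mem-toℕ p)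

∣p[x]≔inside∣ : ∀ {n} (p : Subset n) x → lookup p x ≡ false → ∣ p [ x ]≔ inside ∣ ≡ suc ∣ p ∣
∣p[x]≔inside∣ (false ∷ p) zero    refl = refl
∣p[x]≔inside∣ (true  ∷ p) (suc x) px   = cong suc (∣p[x]≔inside∣ p x px)
∣p[x]≔inside∣ (false ∷ p) (suc x) px   = ∣p[x]≔inside∣ p x px

∣p[x]≔outside∣ : ∀ {n} (p : Subset n) x → lookup p x ≡ true → suc ∣ p [ x ]≔ outside ∣ ≡ ∣ p ∣
∣p[x]≔outside∣ (true  ∷ p) zero    refl = refl
∣p[x]≔outside∣ (true  ∷ p) (suc x) px   = cong suc (∣p[x]≔outside∣ p x px)
∣p[x]≔outside∣ (false ∷ p) (suc x) px   = ∣p[x]≔outside∣ p x px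

∣swap∣ : ∀ {n} (p : Subset n) {v u} → v ∈ p → u ∉ p → ∣ swap p v u ∣ ≡ ∣ p ∣
∣swap∣ p {v} {u} v∈p u∉p = trans
  (∣p[x]≔inside∣ (p [ v ]≔ outside) u (trans (lookup∘update′ u≢v p outside) (∉⇒lookup≡false u∉p)))
  (∣p[x]≔outside∣ p v ([]=⇒lookup v∈p))
  where
  u≢v : u ≢ v
  u≢v refl = u∉p v∈p

swap-removed : ∀ {n} (p : Subset n) {v u} → v ≢ u → lookup (swap p v u) v ≡ false
swap-removed p {v} {u} v≢u =
  trans (lookup∘update′ v≢u (p [ v ]≔ outside) inside) (lookup∘update v p outside)

swap-kept : ∀ {n} {p : Subset n} {v u x} → x ∈ p → x ≢ v → x ≢ u → x ∈ swap p v u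
swap-kept {p = p} {v} {u} {x} x∈p x≢v x≢u =
  []≔-minimal (p [ v ]≔ outside) x u x≢u ([]≔-minimal p x v x≢v x∈p)

swap-added : ∀ {n} (p : Subset n) v u → u ∈ swap p v u
swap-added p v u = []≔-updates (p [ v ]≔ outside) u

centre-dominates : ∀ {n} {S : Subset n} {c u : Fin n} →
  toℕ c ≡ 0 → c ∈ S → u ∈ S → toℕ u ≢ 0 → TotalDominating (Fan n) S
centre-dominates {c = c} {u} c≡0 c∈S u∈S u≢0 x with toℕ x ≟ℕ 0
... | yes x≡0 = u , u∈S , inj₁ (inj₂ (x≡0 , n≢0⇒n>0 u≢0))
... | no  x≢0 = c , c∈S , inj₂ (inj₂ (c≡0 , n≢0⇒n>0 x≢0))

spine-neighbour : ∀ {s b} → FanAdjacent (suc s) b → b ≢ 0 → b ≡ s ⊎ b ≡ 2 + s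
spine-neighbour (inj₁ (inj₁ (_ , refl))) _   = inj₂ refl
spine-neighbour (inj₂ (inj₁ (_ , refl))) _   = inj₁ refl
spine-neighbour (inj₂ (inj₂ (refl , _))) b≢0 = ⊥-elim (b≢0 refl)

-- Vertex s + 1 has a neighbour other than the centre in T.
SpineDominated : ∀ {n} → Subset n → ℕ → Set
SpineDominated T s = mem T s ≡ true ⊎ mem T (2 + s) ≡ true

spine-dominated : ∀ {n} {T : Subset n} {x y : Fin n} {s} →
  toℕ x ≡ suc s → y ∈ T → Fan n x y → toℕ y ≢ 0 → SpineDominated T s
spine-dominated {T = T} {x} {y} x≡1+s y∈T xy y≢0 =
  Sum.map at at (spine-neighbour (subst (λ a → FanAdjacent a (toℕ y)) x≡1+s xy) y≢0)
  where
  at : ∀ {i} → toℕ y ≡ i → mem T i ≡ true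
  at refl = ∈⇒mem y∈T

centre-free-spine-dominated : ∀ {n} {T : Subset n} → TotalDominating (Fan n) T → mem T 0 ≡ false →
  ∀ x {s} → toℕ x ≡ suc s → SpineDominated T s
centre-free-spine-dominated {T = T} dom 0∉T x x≡1+s with dom x
... | y , y∈T , xy = spine-dominated x≡1+s y∈T xy λ y≡0 →
  true≢false (trans (sym (∈⇒mem y∈T)) (trans (cong (mem T) y≡0) 0∉T))

spine-dominated⇒count : ∀ {n} {T : Subset n} {s} → SpineDominated T s → 1 ≤ count (mem T) s 3
spine-dominated⇒count {T = T} {s} =
  [ count-hit (mem T) s {0} {3} (s≤s z≤n) , count-hit (mem T) s {2} {3} (s≤s (s≤s (s≤s z≤n))) ]

3k+1≡1+k*3 : ∀ k → 3 * k + 1 ≡ suc (k * 3)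
3k+1≡1+k*3 k = trans (+-comm (3 * k) 1) (cong suc (*-comm 3 k))

vertex : ∀ k i → i ≤ k * 3 → Fin (3 * k + 1)
vertex k i i≤3k = fromℕ< (subst (i <_) (sym (3k+1≡1+k*3 k)) (s≤s i≤3k))

toℕ-vertex : ∀ k i (i≤3k : i ≤ k * 3) → toℕ (vertex k i i≤3k) ≡ i
toℕ-vertex k i i≤3k = toℕ-fromℕ< _

∣T∣≡count : ∀ k (T : Subset (3 * k + 1)) → ∣ T ∣ ≡ count (mem T) 0 (suc (k * 3))
∣T∣≡count k T = trans (∣p∣≡count-mem T) (cong (count (mem T) 0) (3k+1≡1+k*3 k))

-- Vertex 1 forces 2 ∈ T and vertex 2 forces 1 or 3; the middle vertex of each later block
-- forces one of its two ends.
centre-free-bound : ∀ k (T : Subset (3 * suc k + 1)) →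
  TotalDominating (G (suc k)) T → mem T 0 ≡ false → 2 + k ≤ ∣ T ∣
centre-free-bound k T dom 0∉T = begin
  2 + k                            ≤⟨ +-mono-≤ first-block (count-blocks f 4 3 k later-block) ⟩
  count f 1 3 + count f 4 (k * 3)  ≡⟨ count-+ f 1 3 (k * 3) ⟨
  count f 1 (3 + k * 3)            ≤⟨ m≤n+m (count f 1 (3 + k * 3)) (bit (f 0)) ⟩
  count f 0 (suc (3 + k * 3))      ≡⟨ ∣T∣≡count (suc k) T ⟨
  ∣ T ∣                            ∎
  where
  open ≤-Reasoning
  f : ℕ → Bool
  f = mem T
  dominated : ∀ s → suc s ≤ 3 + k * 3 → SpineDominated T s
  dominated s 1+s≤ =
    centre-free-spine-dominated dom 0∉T (vertex (suc k) (suc s) 1+s≤) (toℕ-vertex (suc k) (suc s) 1+s≤)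
  first-block : 2 ≤ count f 1 3
  first-block = two-of-three f 2∈T (dominated 1 (s≤s (s≤s z≤n)))
    where
    2∈T : f 2 ≡ true
    2∈T = [ (λ 0∈T → ⊥-elim (true≢false (trans (sym 0∈T) 0∉T))) , id ]′ (dominated 0 (s≤s z≤n))
  later-block : ∀ (j : Fin k) → 1 ≤ count f (4 + toℕ j * 3) 3
  later-block j = spine-dominated⇒count {T = T}
    (dominated (4 + toℕ j * 3) (≤-trans (n≤1+n _) (+-monoʳ-≤ 3 (*-monoˡ-≤ 3 (toℕ<n j)))))

missed-block-bound : ∀ k (T : Subset (3 * suc k + 1)) → SecureTotalDominating (G (suc k)) T →
  (j : Fin (suc k)) → ¬ 1 ≤ count (mem T) (1 + toℕ j * 3) 3 → 2 + k ≤ ∣ T ∣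
missed-block-bound k T (_ , defend) j missed = exchange (defend x x∉T)
  where
  s : ℕ
  s = 1 + toℕ j * 3
  s<3+3k : suc s ≤ 3 + k * 3
  s<3+3k = ≤-trans (+-monoʳ-≤ 2 (*-monoˡ-≤ 3 (s≤s⁻¹ (toℕ<n j)))) (n≤1+n _)
  x : Fin (3 * suc k + 1)
  x = vertex (suc k) (suc s) s<3+3k
  x≡1+s : toℕ x ≡ suc s
  x≡1+s = toℕ-vertex (suc k) (suc s) s<3+3k
  x∉T : x ∉ T
  x∉T x∈T = missed (count-hit (mem T) s {1} {3} (s≤s (s≤s z≤n))
    (trans (cong (mem T) (sym x≡1+s)) (∈⇒mem x∈T)))
  exchange : (∃ λ v → v ∈ T × G (suc k) x v × TotalDominating (G (suc k)) (swap T v x)) →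
    2 + k ≤ ∣ T ∣
  exchange (v , v∈T , xv , dom′) = begin
    2 + k           ≤⟨ centre-free-bound k (swap T v x) dom′ 0∉T′ ⟩
    ∣ swap T v x ∣  ≡⟨ ∣swap∣ T v∈T x∉T ⟩
    ∣ T ∣           ∎
    where
    open ≤-Reasoning
    v≡0 : toℕ v ≡ 0
    v≡0 with toℕ v ≟ℕ 0
    ... | yes v≡0 = v≡0
    ... | no  v≢0 =
      ⊥-elim (missed (spine-dominated⇒count {T = T} (spine-dominated x≡1+s v∈T xv v≢0)))
    0∉T′ : mem (swap T v x) 0 ≡ false
    0∉T′ = trans (cong (mem (swap T v x)) (sym v≡0))
      (trans (mem-toℕ (swap T v x) v) (swap-removed T λ { refl → x∉T v∈T }))

secure-bound : ∀ k (T : Subset (3 * suc k + 1)) → SecureTotalDominating (G (suc k)) T → 2 + k ≤ ∣ T ∣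
secure-bound k T secure@(dom , _)
  with mem T 0 in 0∈?T | all? (λ j → 1 ≤? count (mem T) (1 + toℕ j * 3) 3)
... | false | _       = centre-free-bound k T dom 0∈?T
... | true  | yes hit = begin
  2 + k                                     ≤⟨ s≤s (count-blocks (mem T) 1 3 (suc k) hit) ⟩
  bit true + count (mem T) 1 (suc k * 3)    ≡⟨ cong (λ b → bit b + count (mem T) 1 (suc k * 3)) 0∈?T ⟨
  count (mem T) 0 (suc (suc k * 3))         ≡⟨ ∣T∣≡count (suc k) T ⟨
  ∣ T ∣                                     ∎
  where open ≤-Reasoning
... | true  | no ¬hit = uncurry (missed-block-bound k T secure) (¬∀⟶∃¬ _ _ (λ j → 1 ≤? _) ¬hit)

γst-lower-bound : ∀ k → 1 ≤ k → ∀ T → SecureTotalDominating (G k) T → k + 1 ≤ ∣ T ∣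
γst-lower-bound (suc k) _ T secure = subst (_≤ ∣ T ∣) (cong suc (+-comm 1 k)) (secure-bound k T secure)

inSk : ℕ → Bool
inSk i = ⌊ i ≟ℕ 0 ⌋ ∨ ⌊ i % 3 ≟ℕ 2 ⌋

∈Sk : ∀ k {x : Fin (3 * k + 1)} {i} → toℕ x ≡ i → inSk i ≡ true → x ∈ Sk k
∈Sk k {x} refl x∈ = lookup⇒[]= x (Sk k) (trans (lookup∘tabulate _ x) x∈)

∉Sk : ∀ k {x : Fin (3 * k + 1)} → x ∉ Sk k → inSk (toℕ x) ≡ false
∉Sk k {x} x∉ = trans (sym (lookup∘tabulate _ x)) (∉⇒lookup≡false x∉)

≡2-mod-3⇒inSk : ∀ i → i % 3 ≡ 2 → inSk i ≡ true
≡2-mod-3⇒inSk i i%3≡2 = trans (cong (λ r → ⌊ i ≟ℕ 0 ⌋ ∨ ⌊ r ≟ℕ 2 ⌋) i%3≡2) (∨-zeroʳ _)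

∣Sk∣ : ∀ k → ∣ Sk k ∣ ≡ k + 1
∣Sk∣ k = begin
  ∣ Sk k ∣                          ≡⟨ ∣p∣≡count (Sk k) inSk (lookup∘tabulate _) ⟩
  count inSk 0 (3 * k + 1)          ≡⟨ cong (count inSk 0) (3k+1≡1+k*3 k) ⟩
  1 + count inSk 1 (k * 3)          ≡⟨ cong suc (count-suc inSk 0 (k * 3)) ⟩
  1 + count (inSk ∘ suc) 0 (k * 3)  ≡⟨ cong suc (count-periodic (inSk ∘ suc) 3 period 0 k) ⟩
  1 + k * 1                         ≡⟨ cong suc (*-identityʳ k) ⟩
  1 + k                             ≡⟨ +-comm 1 k ⟩
  k + 1                             ∎
  where
  open ≡-Reasoning
  period : ∀ i → inSk (suc (i + 3)) ≡ inSk (suc i)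
  period i = cong (λ r → ⌊ r ≟ℕ 2 ⌋) ([m+n]%n≡m%n (suc i) 3)

one-of-three-≡2-mod-3 : ∀ i → i % 3 ≡ 2 ⊎ suc i % 3 ≡ 2 ⊎ (2 + i) % 3 ≡ 2
one-of-three-≡2-mod-3 0                   = inj₂ (inj₂ refl)
one-of-three-≡2-mod-3 1                   = inj₂ (inj₁ refl)
one-of-three-≡2-mod-3 2                   = inj₁ refl
one-of-three-≡2-mod-3 (suc (suc (suc i))) = one-of-three-≡2-mod-3 i

Sk-neighbour : ∀ k (u : Fin (3 * k + 1)) → u ∉ Sk k → ∃ λ v → v ∈ Sk k × G k u v × toℕ v ≢ 0
Sk-neighbour k u u∉Sk = neighbour (toℕ u) refl u≤3k (∉Sk k u∉Sk)
  where
  u≤3k : toℕ u ≤ k * 3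
  u≤3k = s≤s⁻¹ (subst (toℕ u <_) (3k+1≡1+k*3 k) (toℕ<n u))
  neighbour : ∀ i → toℕ u ≡ i → i ≤ k * 3 → inSk i ≡ false →
    ∃ λ v → v ∈ Sk k × G k u v × toℕ v ≢ 0
  neighbour zero    _      _      ()
  neighbour (suc i) u≡1+i 1+i≤3k 1+i∉ with one-of-three-≡2-mod-3 i
  ... | inj₁ i%3≡2 =
    v , ∈Sk k v≡i (≡2-mod-3⇒inSk i i%3≡2) , inj₂ (inj₁ (1≤v , trans u≡1+i (cong suc (sym v≡i)))) ,
    λ v≡0 → <-irrefl (sym v≡0) 1≤v
    where
    i≤3k : i ≤ k * 3
    i≤3k = ≤-trans (n≤1+n i) 1+i≤3k
    v : Fin (3 * k + 1)
    v = vertex k i i≤3k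
    v≡i : toℕ v ≡ i
    v≡i = toℕ-vertex k i i≤3k
    positive : ∀ m → m % 3 ≡ 2 → 1 ≤ m
    positive (suc _) _ = s≤s z≤n
    1≤v : 1 ≤ toℕ v
    1≤v = subst (1 ≤_) (sym v≡i) (positive i i%3≡2)
  ... | inj₂ (inj₁ 1+i%3≡2) = ⊥-elim (true≢false (trans (sym (≡2-mod-3⇒inSk (suc i) 1+i%3≡2)) 1+i∉))
  ... | inj₂ (inj₂ 2+i%3≡2) =
    v , ∈Sk k v≡2+i (≡2-mod-3⇒inSk (2 + i) 2+i%3≡2) ,
    inj₁ (inj₁ (subst (1 ≤_) (sym u≡1+i) (s≤s z≤n) , trans v≡2+i (cong suc (sym u≡1+i)))) ,
    λ v≡0 → case trans (sym v≡2+i) v≡0 of λ ()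
    where
    -- i + 1 = 3k is impossible, since 3k + 1 ≢ 2 (mod 3).
    2+i≤3k : 2 + i ≤ k * 3
    2+i≤3k = ≤∧≢⇒< 1+i≤3k λ 1+i≡3k →
      case trans (sym ([m+kn]%n≡m%n 1 k 3)) (trans (cong (λ m → suc m % 3) (sym 1+i≡3k)) 2+i%3≡2)
      of λ ()
    v : Fin (3 * k + 1)
    v = vertex k (2 + i) 2+i≤3k
    v≡2+i : toℕ v ≡ 2 + i
    v≡2+i = toℕ-vertex k (2 + i) 2+i≤3k

Sk-secure : ∀ k → 1 ≤ k → SecureTotalDominating (G k) (Sk k)
Sk-secure k 1≤k = centre-dominates c≡0 c∈Sk 2∈Sk 2≢0 , defend
  where
  c : Fin (3 * k + 1)
  c = vertex k 0 z≤n
  c≡0 : toℕ c ≡ 0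
  c≡0 = toℕ-vertex k 0 z≤n
  c∈Sk : c ∈ Sk k
  c∈Sk = ∈Sk k c≡0 refl
  2≤3k : 2 ≤ k * 3
  2≤3k = ≤-trans (n≤1+n 2) (*-monoˡ-≤ 3 1≤k)
  2∈Sk : vertex k 2 2≤3k ∈ Sk k
  2∈Sk = ∈Sk k (toℕ-vertex k 2 2≤3k) refl
  2≢0 : toℕ (vertex k 2 2≤3k) ≢ 0
  2≢0 2≡0 = case trans (sym (toℕ-vertex k 2 2≤3k)) 2≡0 of λ ()
  defend : ∀ u → u ∉ Sk k → ∃ λ v → v ∈ Sk k × G k u v × TotalDominating (G k) (swap (Sk k) v u)
  defend u u∉Sk with Sk-neighbour k u u∉Sk
  ... | v , v∈Sk , uv , v≢0 = v , v∈Sk , uv ,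
    centre-dominates c≡0 (swap-kept c∈Sk c≢v c≢u) (swap-added (Sk k) v u) u≢0
    where
    c≢v : c ≢ v
    c≢v refl = v≢0 c≡0
    c≢u : c ≢ u
    c≢u refl = u∉Sk c∈Sk
    u≢0 : toℕ u ≢ 0
    u≢0 u≡0 = c≢u (toℕ-injective (trans c≡0 (sym u≡0)))

ceiling-formula : ∀ k → k + 1 ≡ (3 * k + 1 + 2 + 2) / 3
ceiling-formula k = sym (begin
  (3 * k + 1 + 2 + 2) / 3   ≡⟨ cong (_/ 3) (rearrange k) ⟩
  (2 + (k + 1) * 3) / 3     ≡⟨ +-distrib-/-∣ʳ 2 {d = 3} (divides-refl (k + 1)) ⟩
  2 / 3 + (k + 1) * 3 / 3   ≡⟨ m*n/n≡m (k + 1) 3 ⟩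
  k + 1                     ∎)
  where
  open ≡-Reasoning
  rearrange : ∀ k → 3 * k + 1 + 2 + 2 ≡ 2 + (k + 1) * 3
  rearrange = solve-∀

mainTheorem5 : (k : ℕ) → 1 ≤ k →
    IsSimple (G k) × MaximalOuterplanar (G k) × GammaST (G k) (k + 1) ×
    (k + 1 ≡ (3 * k + 1 + 2 + 2) / 3) × MinimumSTD (G k) (Sk k)
mainTheorem5 k 1≤k =
  Fan-simple _ , Fan-maximal-outerplanar _ ,
  ((Sk k , Sk-secure k 1≤k , ∣Sk∣ k) , γst-lower-bound k 1≤k) ,
  ceiling-formula k ,
  (Sk-secure k 1≤k ,
   λ T secure → subst (_≤ ∣ T ∣) (sym (∣Sk∣ k)) (γst-lower-bound k 1≤k T secure))
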